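{- The class consisting of all finite linear orderings together with all copies of $\mathbb{Q}$ is $2$-universal for the class of countable linear orderings. In particular, the class of copies of $\mathbb{Q}$ is $2$-universal for the class of countably infinite linear orderings.
   Context: Let $K_0\subseteq K_1$ be isomorphism-invariant classes of countable structures. $K_0$ is $\alpha$-universal for $K_1$ if for every $\mathcal{A}\in K_1$ there is $\mathcal{B}\in K_0$ with $\mathcal{A}\le_\alpha\mathcal{B}$. Here $\mathcal{A}\le_\alpha\mathcal{B}$ means every $\Pi^{\mathrm{in}}_\alpha$ sentence true in $\mathcal{A}$ is true in $\mathcal{B}$, where $\Pi^{\mathrm{in}}_0$ are the finitary quantifier-free formulas and $\Pi^{\mathrm{in}}_\alpha$ formulas are countable conjunctions of $\forall\bar x\,\varphi$ with $\varphi$ a $\Sigma^{\mathrm{in}}_\gamma$ formula, $\gamma<\alpha$ ($\Sigma^{\mathrm{in}}_\gamma$ dual). -}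

module Defs where

open import Level using (0ℓ)
open import Data.Nat using (ℕ; zero; suc; _+_; _<_)
open import Data.Fin using (Fin; splitAt)
open import Data.Sum using (_⊎_; [_,_]′)
open import Data.Product using (Σ; ∃; _×_; _,_)
open import Function.Definitions using (Injective)
open import Function.Bundles using (_↔_; Inverse)
open import Relation.Binary.PropositionalEquality using (_≡_)
open import Relation.Binary.Structures using (IsStrictTotalOrder)
open import Relation.Nullary using (¬_)
import Data.Rational as ℚ

record LinOrd : Set₁ where
  field
    Carrier : Set
    _≺_     : Carrier → Carrier → Set
    isSTO   : IsStrictTotalOrder _≡_ _≺_

open LinOrd public

-- countable = injects into ℕ (includes finite)
Countable : Set → Set
Countable A = Σ (A → ℕ) λ f → Injective _≡_ _≡_ f

IsCountableLO : LinOrd → Set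
IsCountableLO M = Countable (Carrier M)

IsCountablyInfiniteLO : LinOrd → Set
IsCountablyInfiniteLO M = Carrier M ↔ ℕ

IsFiniteLO : LinOrd → Set
IsFiniteLO M = ∃ λ n → Carrier M ↔ Fin n

ℚLO : LinOrd
ℚLO = record
  { Carrier = ℚ.ℚ
  ; _≺_ = ℚ._<_
  ; isSTO = Data-Rational-<-isSTO }
  where open import Data.Rational.Properties renaming (<-isStrictTotalOrder to Data-Rational-<-isSTO)

_≅_ : LinOrd → LinOrd → Set
M ≅ N = Σ (Carrier M ↔ Carrier N) λ f →
  ∀ x y → (_≺_ M x y → _≺_ N (Inverse.to f x) (Inverse.to f y))
        × (_≺_ N (Inverse.to f x) (Inverse.to f y) → _≺_ M x y)

IsCopyOfℚ : LinOrd → Set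
IsCopyOfℚ M = M ≅ ℚLO

data QF (k : ℕ) : Set where
  _≐_  : Fin k → Fin k → QF k
  _≺'_ : Fin k → Fin k → QF k
  ¬'_  : QF k → QF k
  _∧'_ : QF k → QF k → QF k
  _∨'_ : QF k → QF k → QF k

-- Π^in_α and Σ^in_α formulas for finite α.  A (co)conjunction / disjunction
-- ranges over a countable index set I; the i-th member quantifies m i new
-- variables (placed before the k old ones) over a formula of level γ i < α.
data Πin : ℕ → ℕ → Set₁
data Σin : ℕ → ℕ → Set₁

data Πin where
  qfΠ : ∀ {k} → QF k → Πin zero k
  ⋀∀  : ∀ {α k} (I : Set) → Countable I →
        (m γ : I → ℕ) → (∀ i → γ i < α) →
        (∀ i → Σin (γ i) (m i + k)) → Πin α k

data Σin where
  qfΣ : ∀ {k} → QF k → Σin zero k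
  ⋁∃  : ∀ {α k} (I : Set) → Countable I →
        (m γ : I → ℕ) → (∀ i → γ i < α) →
        (∀ i → Πin (γ i) (m i + k)) → Σin α k

extend : ∀ {A : Set} m {k} → (Fin m → A) → (Fin k → A) → Fin (m + k) → A
extend m ys ρ i = [ ys , ρ ]′ (splitAt m i)

module _ (M : LinOrd) where
  private A = Carrier M

  satQF : ∀ {k} → QF k → (Fin k → A) → Set
  satQF (x ≐ y)   ρ = ρ x ≡ ρ y
  satQF (x ≺' y)  ρ = _≺_ M (ρ x) (ρ y)
  satQF (¬' φ)    ρ = ¬ satQF φ ρ
  satQF (φ ∧' ψ)  ρ = satQF φ ρ × satQF ψ ρ
  satQF (φ ∨' ψ)  ρ = satQF φ ρ ⊎ satQF ψ ρ

  satΠ : ∀ {α k} → Πin α k → (Fin k → A) → Set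
  satΣ : ∀ {α k} → Σin α k → (Fin k → A) → Set
  satΠ (qfΠ φ) ρ = satQF φ ρ
  satΠ (⋀∀ I _ m γ _ φ) ρ = (i : I) → (ys : Fin (m i) → A) → satΣ (φ i) (extend (m i) ys ρ)
  satΣ (qfΣ φ) ρ = satQF φ ρ
  satΣ (⋁∃ I _ m γ _ φ) ρ = Σ I λ i → Σ (Fin (m i) → A) λ ys → satΠ (φ i) (extend (m i) ys ρ)

ε : ∀ {A : Set} → Fin 0 → A
ε ()

_≤[_]_ : LinOrd → ℕ → LinOrd → Set₁
M ≤[ α ] N = (φ : Πin α 0) → satΠ M φ ε → satΠ N φ ε

Universal : ℕ → (LinOrd → Set) → (LinOrd → Set) → Set₁
Universal α K0 K1 = ∀ M → K1 M → ∃ λ N → K0 N × (M ≤[ α ] N)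

-- Classically, a linear order M is either finite or has finite chains of every
-- length; in the first case M itself is the required structure.  In the second
-- case M ≤₂ ℚ: given a Π₂ sentence ∀x̄ ∃ȳ θ true in M and rationals x̄, copy x̄
-- in the same order onto a chain of M, take witnesses ȳ there, and carry them
-- back to ℚ, which (dense without endpoints) extends every finite partial
-- isomorphism from M by any further point.  A countably infinite order is never
-- finite, so it always falls into the second case.

module Submission where

open import Defs
open import Level using (0ℓ)
open import Data.Empty using (⊥-elim)
open import Data.Fin using (Fin; zero; suc; splitAt; fromℕ<)
import Data.Fin.Properties as Finₚ
open import Data.Fin.Subset using (Subset; ∣_∣; _∈_; _⊂_)
open import Data.Fin.Subset.Properties using (∣p∣≤n; p⊂q⇒∣p∣<∣q∣)
open import Data.List using (List; []; _∷_; length; lookup)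
open import Data.List.Membership.Propositional using () renaming (_∈_ to _∈ₗ_)
open import Data.List.Membership.Propositional.Properties using (∈-lookup)
open import Data.List.Relation.Unary.All as All using (All; []; _∷_)
open import Data.List.Relation.Unary.AllPairs using (AllPairs; []; _∷_)
open import Data.List.Relation.Unary.Any using (here; there; index)
open import Data.List.Relation.Unary.Any.Properties using (lookup-index)
open import Data.Nat using (ℕ; zero; suc; _≤_; z≤n; s≤s)
import Data.Nat as ℕ
import Data.Fin as Fin
import Data.Nat.Properties as ℕₚ
open import Data.Product using (Σ; ∃; _×_; _,_; proj₁; proj₂)
open import Data.Product.Function.NonDependent.Propositional using (_×-⇔_)
open import Data.Rational using (ℚ; 0ℚ; 1ℚ; _+_; -_; _<_)
import Data.Rational.Properties as ℚₚ
open import Data.Sum using (_⊎_; inj₁; inj₂)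
open import Data.Sum.Function.Propositional using (_⊎-⇔_)
open import Data.Vec using (tabulate)
open import Data.Vec.Functional using (tail) renaming (_∷_ to _∷ᵥ_)
open import Data.Vec.Properties using (lookup∘tabulate; lookup⇒[]=; []=⇒lookup)
open import Function using (_∘_)
open import Function.Bundles using (_⇔_; mk⇔; _↔_; mk↔ₛ′; Injection; Equivalence)
open import Function.Construct.Symmetry using (⇔-sym)
open import Function.Construct.Identity using (↔-id)
open import Function.Properties.Inverse using (↔-sym; ↔-trans; ↔⇒↣)
open import Function.Related.TypeIsomorphisms using (¬-cong-⇔)
open import Axiom.ExcludedMiddle using (ExcludedMiddle)
open import Axiom.DoubleNegationElimination using (DoubleNegationElimination; em⇒dne)
open import Relation.Binary.Bundles using (TotalPreorder)
import Relation.Binary.Construct.Flip.EqAndOrd as Flip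
open import Relation.Binary.Definitions using (tri<; tri≈; tri>)
open import Relation.Binary.PropositionalEquality
  using (_≡_; refl; sym; trans; cong; subst; subst₂; _≗_)
open import Relation.Binary.Structures using (IsStrictTotalOrder)
open import Relation.Nullary using (¬_; yes; no; does; proof)
open import Relation.Nullary.Decidable using (dec-true)
open import Relation.Nullary.Reflects using (Reflects; invert)
open import Relation.Unary using (Pred; Decidable)

SameType : (M N : LinOrd) {J : Set} → (J → Carrier M) → (J → Carrier N) → Set
SameType M N ρ σ = ∀ i j → (ρ i ≡ ρ j ⇔ σ i ≡ σ j) × (_≺_ M (ρ i) (ρ j) ⇔ _≺_ N (σ i) (σ j))

module _ (M N : LinOrd) where
  private
    module M = IsStrictTotalOrder (isSTO M)
    module N = IsStrictTotalOrder (isSTO N)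
    _≺M_ : Carrier M → Carrier M → Set
    _≺M_ = _≺_ M
    _≺N_ : Carrier N → Carrier N → Set
    _≺N_ = _≺_ N

  SameType-sym : ∀ {J} {ρ : J → Carrier M} {σ : J → Carrier N} →
                 SameType M N ρ σ → SameType N M σ ρ
  SameType-sym s i j = ⇔-sym (proj₁ (s i j)) , ⇔-sym (proj₂ (s i j))

  SameType-resp : ∀ {J} {ρ ρ′ : J → Carrier M} {σ σ′ : J → Carrier N} →
                  ρ′ ≗ ρ → σ′ ≗ σ → SameType M N ρ σ → SameType M N ρ′ σ′
  SameType-resp eρ eσ s i j rewrite eρ i | eρ j | eσ i | eσ j = s i j

  preserves⇒SameType : ∀ {J} {ρ : J → Carrier M} {σ : J → Carrier N} →
                       (∀ i j → ρ i ≡ ρ j → σ i ≡ σ j) →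
                       (∀ i j → ρ i ≺M ρ j → σ i ≺N σ j) →
                       SameType M N ρ σ
  preserves⇒SameType {ρ = ρ} {σ} pres-≡ pres-≺ i j =
    mk⇔ (pres-≡ i j) reflect-≡ , mk⇔ (pres-≺ i j) reflect-≺
    where
    reflect-≡ : σ i ≡ σ j → ρ i ≡ ρ j
    reflect-≡ e with M.compare (ρ i) (ρ j)
    ... | tri< x _ _ = ⊥-elim (N.irrefl e (pres-≺ i j x))
    ... | tri≈ _ e′ _ = e′
    ... | tri> _ _ y = ⊥-elim (N.irrefl (sym e) (pres-≺ j i y))
    reflect-≺ : σ i ≺N σ j → ρ i ≺M ρ j
    reflect-≺ x with M.compare (ρ i) (ρ j)
    ... | tri< y _ _ = y
    ... | tri≈ _ e _ = ⊥-elim (N.irrefl (pres-≡ i j e) x)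
    ... | tri> _ _ y = ⊥-elim (N.asym x (pres-≺ j i y))

  SamePosition : ∀ {n} → (Fin n → Carrier M) → (Fin n → Carrier N) → Carrier M → Carrier N → Set
  SamePosition ρ σ a b = ∀ j → (a ≡ ρ j → b ≡ σ j) × (a ≺M ρ j → b ≺N σ j) × (ρ j ≺M a → σ j ≺N b)

  SameType-∷ : ∀ {n} {ρ : Fin n → Carrier M} {σ : Fin n → Carrier N} {a b} →
               SameType M N ρ σ → SamePosition ρ σ a b → SameType M N (a ∷ᵥ ρ) (b ∷ᵥ σ)
  SameType-∷ {ρ = ρ} {σ} {a} {b} s pos = preserves⇒SameType pres-≡ pres-≺
    where
    pres-≡ : ∀ i j → (a ∷ᵥ ρ) i ≡ (a ∷ᵥ ρ) j → (b ∷ᵥ σ) i ≡ (b ∷ᵥ σ) j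
    pres-≡ zero    zero    _ = refl
    pres-≡ zero    (suc j) e = proj₁ (pos j) e
    pres-≡ (suc i) zero    e = sym (proj₁ (pos i) (sym e))
    pres-≡ (suc i) (suc j) e = Equivalence.to (proj₁ (s i j)) e
    pres-≺ : ∀ i j → (a ∷ᵥ ρ) i ≺M (a ∷ᵥ ρ) j → (b ∷ᵥ σ) i ≺N (b ∷ᵥ σ) j
    pres-≺ zero    zero    x = ⊥-elim (M.irrefl refl x)
    pres-≺ zero    (suc j) x = proj₁ (proj₂ (pos j)) x
    pres-≺ (suc i) zero    x = proj₂ (proj₂ (pos i)) x
    pres-≺ (suc i) (suc j) x = Equivalence.to (proj₂ (s i j)) x

  satQF-cong : ∀ {k} {ρ : Fin k → Carrier M} {σ : Fin k → Carrier N} →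
               SameType M N ρ σ → (φ : QF k) → satQF M φ ρ ⇔ satQF N φ σ
  satQF-cong s (x ≐ y)  = proj₁ (s x y)
  satQF-cong s (x ≺' y) = proj₂ (s x y)
  satQF-cong s (¬' φ)   = ¬-cong-⇔ (satQF-cong s φ)
  satQF-cong s (φ ∧' ψ) = satQF-cong s φ ×-⇔ satQF-cong s ψ
  satQF-cong s (φ ∨' ψ) = satQF-cong s φ ⊎-⇔ satQF-cong s ψ

  satΠ₀-transfer : ∀ {α k} (φ : Πin α k) → α ℕ.< 1 →
                   ∀ {ρ : Fin k → Carrier M} {σ : Fin k → Carrier N} →
                   SameType M N ρ σ → satΠ M φ ρ → satΠ N φ σ
  satΠ₀-transfer (qfΠ φ)           _         s h = Equivalence.to (satQF-cong s φ) h
  satΠ₀-transfer (⋀∀ _ _ _ _ γ<α _) (s≤s z≤n) s h i = ⊥-elim (ℕₚ.n≮0 (γ<α i))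

  SameType-extend-ε : ∀ m {ys : Fin m → Carrier M} {zs : Fin m → Carrier N} →
                      SameType M N ys zs → SameType M N (extend m ys ε) (extend m zs ε)
  SameType-extend-ε m s i j with splitAt m i | splitAt m j
  ... | inj₁ x  | inj₁ y  = s x y
  ... | inj₁ _  | inj₂ ()
  ... | inj₂ () | _

  RealizesConfigurationsOf : Set
  RealizesConfigurationsOf = ∀ m (zs : Fin m → Carrier N) → ∃ λ ys → SameType M N ys zs

  OnePointExtension : Set
  OnePointExtension = ∀ {n} {ρ : Fin n → Carrier M} {σ : Fin n → Carrier N} →
                      SameType M N ρ σ → ∀ a → ∃ λ b → SameType M N (a ∷ᵥ ρ) (b ∷ᵥ σ)

  extend-∷ : ∀ {X : Set} m {k} (ys : Fin (suc m) → X) (ρ : Fin k → X) →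
             extend (suc m) ys ρ ≗ ys zero ∷ᵥ extend m (tail ys) ρ
  extend-∷ m ys ρ zero = refl
  extend-∷ m ys ρ (suc i) with splitAt m i
  ... | inj₁ _ = refl
  ... | inj₂ _ = refl

  extension⇒extendMany : OnePointExtension →
                         ∀ {k} {ρ : Fin k → Carrier M} {σ : Fin k → Carrier N} →
                         SameType M N ρ σ → ∀ m (ys : Fin m → Carrier M) →
                         ∃ λ zs → SameType M N (extend m ys ρ) (extend m zs σ)
  extension⇒extendMany ext s zero    ys = (λ ()) , s
  extension⇒extendMany ext {ρ = ρ} {σ} s (suc m) ys =
    let zs , s′ = extension⇒extendMany ext s m (tail ys)
        b , s″ = ext s′ (ys zero)
    in b ∷ᵥ zs , SameType-resp (extend-∷ m ys ρ) (extend-∷ m (b ∷ᵥ zs) σ) s″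

  satΣ₁-transfer : OnePointExtension → ∀ {α k} (ψ : Σin α k) → α ℕ.< 2 →
                   ∀ {ρ : Fin k → Carrier M} {σ : Fin k → Carrier N} →
                   SameType M N ρ σ → satΣ M ψ ρ → satΣ N ψ σ
  satΣ₁-transfer ext (qfΣ φ) _ s h = Equivalence.to (satQF-cong s φ) h
  satΣ₁-transfer ext (⋁∃ _ _ m _ γ<α φ) α<2 s (i , ys , h) =
    let zs , s′ = extension⇒extendMany ext s (m i) ys
    in i , zs , satΠ₀-transfer (φ i) (ℕₚ.<-≤-trans (γ<α i) (ℕₚ.≤-pred α<2)) s′ h

  realizes∧extends⇒≤₂ : RealizesConfigurationsOf → OnePointExtension → M ≤[ 2 ] N
  realizes∧extends⇒≤₂ realize ext (⋀∀ _ _ m _ γ<2 ψ) h i zs =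
    let ys , s = realize (m i) zs
    in satΣ₁-transfer ext (ψ i) (γ<2 i) (SameType-extend-ε (m i) s) (h i ys)

module _ (T : TotalPreorder 0ℓ 0ℓ 0ℓ) where
  open TotalPreorder T using (_≲_; total) renaming (Carrier to C; refl to ≲-refl; trans to ≲-trans)

  greatest : ∀ {n} (f : Fin n → C) {P : Pred (Fin n) 0ℓ} → Decidable P →
             (∀ i → ¬ P i) ⊎ ∃ λ i → P i × ∀ j → P j → f j ≲ f i
  greatest {zero}  f P? = inj₁ λ ()
  greatest {suc n} f P? with P? zero | greatest (f ∘ suc) (P? ∘ suc)
  ... | no ¬p₀ | inj₁ none = inj₁ λ { zero → ¬p₀ ; (suc i) → none i }
  ... | no ¬p₀ | inj₂ (i , pᵢ , max) =
    inj₂ (suc i , pᵢ , λ { zero p₀ → ⊥-elim (¬p₀ p₀) ; (suc j) → max j })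
  ... | yes p₀ | inj₁ none =
    inj₂ (zero , p₀ , λ { zero _ → ≲-refl ; (suc j) pⱼ → ⊥-elim (none j pⱼ) })
  ... | yes p₀ | inj₂ (i , pᵢ , max) with total (f zero) (f (suc i))
  ...   | inj₁ f₀≲fᵢ = inj₂ (suc i , pᵢ , λ { zero _ → f₀≲fᵢ ; (suc j) → max j })
  ...   | inj₂ fᵢ≲f₀ = inj₂ (zero , p₀ , λ { zero _ → ≲-refl ; (suc j) pⱼ → ≲-trans (max j pⱼ) fᵢ≲f₀ })

ℚ-noMax : ∀ p → ∃ λ q → p < q
ℚ-noMax p = p + 1ℚ , subst (_< p + 1ℚ) (ℚₚ.+-identityʳ p) (ℚₚ.+-monoʳ-< p (ℚₚ.positive⁻¹ 1ℚ))

ℚ-noMin : ∀ p → ∃ λ q → q < p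
ℚ-noMin p = p + - 1ℚ , subst (p + - 1ℚ <_) (ℚₚ.+-identityʳ p)
                        (ℚₚ.+-monoʳ-< p (ℚₚ.neg-antimono-< (ℚₚ.positive⁻¹ 1ℚ)))

ℚ-interpolate : ∀ {n} (σ : Fin n → ℚ) {L U : Pred (Fin n) 0ℓ} → Decidable L → Decidable U →
                (∀ i j → L i → U j → σ i < σ j) →
                ∃ λ q → (∀ i → L i → σ i < q) × (∀ j → U j → q < σ j)
ℚ-interpolate σ L? U? L<U
  with greatest ℚₚ.≤-totalPreorder σ L? | greatest (Flip.totalPreorder ℚₚ.≤-totalPreorder) σ U?
... | inj₁ noL | inj₁ noU = 0ℚ , (λ i l → ⊥-elim (noL i l)) , (λ j u → ⊥-elim (noU j u))
... | inj₂ (i , lᵢ , max) | inj₁ noU =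
  let q , σᵢ<q = ℚ-noMax (σ i)
  in q , (λ k lₖ → ℚₚ.≤-<-trans (max k lₖ) σᵢ<q) , (λ k uₖ → ⊥-elim (noU k uₖ))
... | inj₁ noL | inj₂ (j , uⱼ , min) =
  let q , q<σⱼ = ℚ-noMin (σ j)
  in q , (λ k lₖ → ⊥-elim (noL k lₖ)) , (λ k uₖ → ℚₚ.<-≤-trans q<σⱼ (min k uₖ))
... | inj₂ (i , lᵢ , max) | inj₂ (j , uⱼ , min) =
  let q , σᵢ<q , q<σⱼ = ℚₚ.<-dense (L<U i j lᵢ uⱼ)
  in q , (λ k lₖ → ℚₚ.≤-<-trans (max k lₖ) σᵢ<q) , (λ k uₖ → ℚₚ.<-≤-trans q<σⱼ (min k uₖ))

module _ (M : LinOrd) where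
  private
    module M = IsStrictTotalOrder (isSTO M)

  ℚ-onePointExtension : OnePointExtension M ℚLO
  ℚ-onePointExtension {ρ = ρ} {σ} s a with Finₚ.any? (λ j → a M.≟ ρ j)
  ... | yes (j₀ , refl) =
    σ j₀ , SameType-∷ M ℚLO s λ j →
      Equivalence.to (proj₁ (s j₀ j)) , Equivalence.to (proj₂ (s j₀ j)) , Equivalence.to (proj₂ (s j j₀))
  ... | no a∉ρ =
    let b , below , above = ℚ-interpolate σ (λ j → ρ j M.<? a) (λ j → a M.<? ρ j)
                              (λ i j ρᵢ<a a<ρⱼ → Equivalence.to (proj₂ (s i j)) (M.trans ρᵢ<a a<ρⱼ))
    in b , SameType-∷ M ℚLO s λ j → (λ e → ⊥-elim (a∉ρ (j , e))) , above j , below j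

Chain : LinOrd → ℕ → Set
Chain M n = Σ (List (Carrier M)) λ cs → AllPairs (_≺_ M) cs × n ≤ length cs

AllPairs-lookup : ∀ {A : Set} {R : A → A → Set} {xs : List A} → AllPairs R xs →
                  ∀ {i j} → i Fin.< j → R (lookup xs i) (lookup xs j)
AllPairs-lookup (r ∷ _)  {zero}  {suc j} _         = All.lookup r (∈-lookup j)
AllPairs-lookup (_ ∷ rs) {suc i} {suc j} (s≤s i<j) = AllPairs-lookup rs i<j

module _ (M N : LinOrd) where
  private
    module M = IsStrictTotalOrder (isSTO M)
    module N = IsStrictTotalOrder (isSTO N)

  -- A configuration z̄ of N is copied onto a chain c₀ < c₁ < … of M by sending
  -- zᵢ to c_r, where r is the number of zⱼ below zᵢ.
  chain⇒realizes : ∀ m → Chain M (suc m) → (zs : Fin m → Carrier N) →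
                   ∃ λ ys → SameType M N ys zs
  chain⇒realizes m (cs , sorted , long) zs =
    G ∘ zs , SameType-sym N M (preserves⇒SameType N M (λ _ _ → cong G) G-mono)
    where
    below : Carrier N → Subset m
    below b = tabulate λ j → does (zs j N.<? b)

    ∈below⁺ : ∀ {j b} → _≺_ N (zs j) b → j ∈ below b
    ∈below⁺ {j} {b} lt = lookup⇒[]= j _ (trans (lookup∘tabulate _ j) (dec-true (zs j N.<? b) lt))

    ∈below⁻ : ∀ {j b} → j ∈ below b → _≺_ N (zs j) b
    ∈below⁻ {j} {b} j∈ =
      invert (subst (Reflects _) (trans (sym (lookup∘tabulate _ j)) ([]=⇒lookup j∈)) (proof (zs j N.<? b)))

    below-⊂ : ∀ {i j} → _≺_ N (zs i) (zs j) → below (zs i) ⊂ below (zs j)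
    below-⊂ {i} zᵢ<zⱼ = (λ k∈ → ∈below⁺ (N.trans (∈below⁻ k∈) zᵢ<zⱼ))
                      , i , ∈below⁺ zᵢ<zⱼ , (λ i∈ → N.irrefl refl (∈below⁻ i∈))

    rank< : ∀ b → ∣ below b ∣ ℕ.< length cs
    rank< b = ℕₚ.<-≤-trans (s≤s (∣p∣≤n (below b))) long

    G : Carrier N → Carrier M
    G b = lookup cs (fromℕ< (rank< b))

    G-mono : ∀ i j → _≺_ N (zs i) (zs j) → _≺_ M (G (zs i)) (G (zs j))
    G-mono i j zᵢ<zⱼ = AllPairs-lookup sorted
      (subst₂ ℕ._<_ (sym (Finₚ.toℕ-fromℕ< _)) (sym (Finₚ.toℕ-fromℕ< _)) (p⊂q⇒∣p∣<∣q∣ (below-⊂ zᵢ<zⱼ)))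

  chains⇒realizes : (∀ n → Chain M n) → RealizesConfigurationsOf M N
  chains⇒realizes chains m = chain⇒realizes m (chains (suc m))

chains⇒≤₂ℚ : ∀ M → (∀ n → Chain M n) → M ≤[ 2 ] ℚLO
chains⇒≤₂ℚ M chains = realizes∧extends⇒≤₂ M ℚLO (chains⇒realizes M ℚLO chains) (ℚ-onePointExtension M)

module _ (M : LinOrd) where
  private
    module M = IsStrictTotalOrder (isSTO M)
    A : Set
    A = Carrier M
    _≺M_ : A → A → Set
    _≺M_ = _≺_ M
    open import Data.List.Membership.DecPropositional M._≟_ using (_∈?_)

  insert : A → List A → List A
  insert a [] = a ∷ []
  insert a (x ∷ xs) with M.compare a x
  ... | tri< _ _ _ = a ∷ x ∷ xs
  ... | tri≈ _ _ _ = x ∷ xs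
  ... | tri> _ _ _ = x ∷ insert a xs

  length-insert : ∀ a xs → ¬ a ∈ₗ xs → length (insert a xs) ≡ suc (length xs)
  length-insert a [] _ = refl
  length-insert a (x ∷ xs) a∉ with M.compare a x
  ... | tri< _ _ _ = refl
  ... | tri≈ _ a≡x _ = ⊥-elim (a∉ (here a≡x))
  ... | tri> _ _ _ = cong suc (length-insert a xs (a∉ ∘ there))

  All-insert : ∀ {P : A → Set} {a} xs → P a → All P xs → All P (insert a xs)
  All-insert [] pa [] = pa ∷ []
  All-insert {a = a} (x ∷ xs) pa (px ∷ pxs) with M.compare a x
  ... | tri< _ _ _ = pa ∷ px ∷ pxs
  ... | tri≈ _ _ _ = px ∷ pxs
  ... | tri> _ _ _ = px ∷ All-insert xs pa pxs

  AllPairs-insert : ∀ a {xs} → AllPairs _≺M_ xs → AllPairs _≺M_ (insert a xs)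
  AllPairs-insert a [] = [] ∷ []
  AllPairs-insert a {x ∷ xs} (x<xs ∷ sorted) with M.compare a x
  ... | tri< a<x _ _ = (a<x ∷ All.map (M.trans a<x) x<xs) ∷ x<xs ∷ sorted
  ... | tri≈ _ _ _ = x<xs ∷ sorted
  ... | tri> _ _ x<a = All-insert xs x<a x<xs ∷ AllPairs-insert a sorted

  maximalChain⇒finite : ∀ {k} → Chain M k → ¬ Chain M (suc k) → IsFiniteLO M
  maximalChain⇒finite {k} (cs , sorted , k≤) maximal =
    length cs , mk↔ₛ′ (index ∘ complete) (lookup cs) index-lookup (sym ∘ lookup-index ∘ complete)
    where
    complete : ∀ a → a ∈ₗ cs
    complete a with a ∈? cs
    ... | yes a∈ = a∈
    ... | no a∉ = ⊥-elim (maximal (insert a cs , AllPairs-insert a sorted ,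
                                   subst (suc k ≤_) (sym (length-insert a cs a∉)) (s≤s k≤)))
    lookup-injective : ∀ {i j} → lookup cs i ≡ lookup cs j → i ≡ j
    lookup-injective {i} {j} e with Finₚ.<-cmp i j
    ... | tri< i<j _ _ = ⊥-elim (M.irrefl e (AllPairs-lookup sorted i<j))
    ... | tri≈ _ i≡j _ = i≡j
    ... | tri> _ _ j<i = ⊥-elim (M.irrefl (sym e) (AllPairs-lookup sorted j<i))
    index-lookup : ∀ i → index (complete (lookup cs i)) ≡ i
    index-lookup i = sym (lookup-injective (lookup-index (complete (lookup cs i))))

chains-or-finite : ExcludedMiddle 0ℓ → ∀ M → (∀ n → Chain M n) ⊎ IsFiniteLO M
chains-or-finite lem M with lem {∀ n → Chain M n}
... | yes chains = inj₁ chains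
... | no ¬chains =
  let n , ¬chain = dne λ none → ¬chains λ n → dne λ ¬chain → none (n , ¬chain)
      k , chain , ¬longer = longest n ¬chain
  in inj₂ (maximalChain⇒finite M chain ¬longer)
  where
  dne : DoubleNegationElimination 0ℓ
  dne = em⇒dne lem
  longest : ∀ n → ¬ Chain M n → ∃ λ k → Chain M k × ¬ Chain M (suc k)
  longest zero    ¬chain = ⊥-elim (¬chain ([] , [] , z≤n))
  longest (suc n) ¬chain with lem {Chain M n}
  ... | yes chain = n , chain , ¬chain
  ... | no ¬chain′ = longest n ¬chain′

countablyInfinite⇒¬finite : ∀ M → IsCountablyInfiniteLO M → ¬ IsFiniteLO M
countablyInfinite⇒¬finite M M↔ℕ (k , M↔Fin) =
  Finₚ.<⇒notInjective (ℕₚ.n<1+n k) (Finₚ.toℕ-injective ∘ Injection.injective (↔⇒↣ ℕ↔Fin))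
  where
  ℕ↔Fin : ℕ ↔ Fin k
  ℕ↔Fin = ↔-trans (↔-sym M↔ℕ) M↔Fin

ℚ-isCopyOfℚ : IsCopyOfℚ ℚLO
ℚ-isCopyOfℚ = ↔-id ℚ , λ _ _ → (λ x → x) , (λ x → x)

mainTheorem18 : ExcludedMiddle 0ℓ →
    Universal 2 (λ M → IsFiniteLO M ⊎ IsCopyOfℚ M) IsCountableLO
    × Universal 2 IsCopyOfℚ IsCountablyInfiniteLO
mainTheorem18 lem = finiteOrℚ , onlyℚ
  where
  finiteOrℚ : Universal 2 (λ M → IsFiniteLO M ⊎ IsCopyOfℚ M) IsCountableLO
  finiteOrℚ M _ with chains-or-finite lem M
  ... | inj₁ chains = ℚLO , inj₂ ℚ-isCopyOfℚ , chains⇒≤₂ℚ M chains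
  ... | inj₂ finite = M , inj₁ finite , λ _ h → h
  onlyℚ : Universal 2 IsCopyOfℚ IsCountablyInfiniteLO
  onlyℚ M M↔ℕ with chains-or-finite lem M
  ... | inj₁ chains = ℚLO , ℚ-isCopyOfℚ , chains⇒≤₂ℚ M chains
  ... | inj₂ finite = ⊥-elim (countablyInfinite⇒¬finite M M↔ℕ finite)
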